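{- Let $\mathcal{P}_1=(E_1,\le_1,\#_1,v_1)$ and $\mathcal{P}_2=(E_2,\le_2,\#_2,v_2)$ be probabilistic event structures and $p\in(0,1)$. Then $\mathcal{P}_1\oplus_p\mathcal{P}_2$ is a probabilistic event structure.
   Context: An event structure is $(E,\le,\#)$ with $\le$ a partial order, $\#$ symmetric irreflexive, $\{e':e'\le e\}$ finite, $e\#e'\le e''\Rightarrow e\#e''$; configurations are conflict-free down-closed subsets, $\mathcal{C}$ the finite ones. A probabilistic event structure is an event structure with $v:\mathcal{C}\to[0,1]$, $v(\emptyset)=1$, and $v(y)-\sum_{\emptyset\ne I\subseteq\{1..n\}}(-1)^{|I|+1}v(\bigcup_{i\in I}x_i)\ge0$ for all $y,x_1,\dots,x_n\in\mathcal{C}$ with $y\subseteq x_i$ ($v(z)=0$ for non-configurations). Probabilistic choice $\mathcal{P}_1\oplus_p\mathcal{P}_2=(E,\le,\#,v)$: $E=\{\tau\}\uplus E_1\uplus E_2$; $\le$ consists of $\tau\le e$ for every $e\in E$ together with $\le_1$ and $\le_2$; $\#$ is $\#_1\cup\#_2$ together with $e_1\#e_2$ (and symmetrically) for all $e_1\in E_1$, $e_2\in E_2$; $v(x)=1$ if $x=\emptyset$ or $x=\{\tau\}$, and otherwise $v(x)=p\cdot v_1(x\setminus\{\tau\})$ if $x\setminus\{\tau\}\in\mathcal{C}(\mathcal{P}_1)$, $v(x)=(1-p)\cdot v_2(x\setminus\{\tau\})$ if $x\setminus\{\tau\}\in\mathcal{C}(\mathcal{P}_2)$. -}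

module Defs where

open import Level using (Level; _⊔_) renaming (suc to lsuc)
open import Data.Nat using (ℕ; zero; suc)
open import Data.Bool using (Bool; true; false)
open import Data.Unit using (⊤; tt)
open import Data.Empty using (⊥)
open import Data.Product using (_×_; _,_)
open import Data.Sum using (_⊎_; inj₁; inj₂)
open import Data.List using (List; []; _∷_; _++_; map; concat; foldr; length)
open import Data.List.Membership.Propositional using (_∈_)
open import Data.List.Relation.Binary.Subset.Propositional using (_⊆_)
open import Data.List.Relation.Unary.All using (All)
open import Relation.Nullary using (¬_)
open import Relation.Binary.PropositionalEquality using (_≡_)
open import Relation.Binary.Structures using (IsTotalOrder)
open import Algebra.Bundles using (CommutativeRing)

-- Totally ordered commutative rings (the values of valuations; ℝ is an
-- instance).  The unit interval [0,1] is {a | 0 ≤ a ≤ 1}.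

record OrderedCommRing (c ℓ : Level) : Set (lsuc (c ⊔ ℓ)) where
  field
    commRing : CommutativeRing c ℓ
  open CommutativeRing commRing public
  infix 4 _≤_
  field
    _≤_          : Carrier → Carrier → Set ℓ
    isTotalOrder : IsTotalOrder _≈_ _≤_
    +-mono-≤     : ∀ {a b} c → a ≤ b → a + c ≤ b + c
    *-nonneg     : ∀ {a b} → 0# ≤ a → 0# ≤ b → 0# ≤ a * b

  infix 4 _<_
  _<_ : Carrier → Carrier → Set ℓ
  a < b = (a ≤ b) × ¬ (a ≈ b)

-- Event structures (E, ≤, #).  Finiteness of {e' | e' ≤ e} is witnessed
-- by a list enumerating exactly that set.

record IsEventStructure {E : Set} (_≤_ _#_ : E → E → Set) : Set where
  field
    ≤-refl    : ∀ e → e ≤ e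
    ≤-trans   : ∀ {e e' e''} → e ≤ e' → e' ≤ e'' → e ≤ e''
    ≤-antisym : ∀ {e e'} → e ≤ e' → e' ≤ e → e ≡ e'
    #-irrefl  : ∀ e → ¬ (e # e)
    #-sym     : ∀ {e e'} → e # e' → e' # e
    #-her     : ∀ {e e' e''} → e # e' → e' ≤ e'' → e # e''
    down      : E → List E
    down-sound    : ∀ {e e'} → e' ∈ down e → e' ≤ e
    down-complete : ∀ {e e'} → e' ≤ e → e' ∈ down e

-- Finite subsets of E are represented by lists (up to same elements).
-- A (finite) configuration: conflict-free and down-closed.
IsConfig : {E : Set} (_≤_ _#_ : E → E → Set) → List E → Set
IsConfig _≤_ _#_ x =
  (∀ {e e'} → e ∈ x → e' ∈ x → ¬ (e # e')) ×
  (∀ {e e'} → e' ≤ e → e ∈ x → e' ∈ x)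

-- Inclusion–exclusion sum  Σ_{∅≠I⊆{1..n}} (-1)^{|I|+1} v(⋃_{i∈I} x_i)

module _ {c ℓ} (R : OrderedCommRing c ℓ) where
  open OrderedCommRing R

  sign : ℕ → Carrier
  sign zero    = 1#
  sign (suc k) = - sign k

  Σ : List Carrier → Carrier
  Σ = foldr _+_ 0#

  subfamilies : {A : Set} → List A → List (List A)
  subfamilies []       = [] ∷ []
  subfamilies (x ∷ xs) = subfamilies xs ++ map (x ∷_) (subfamilies xs)

  ieSum : {E : Set} → (List E → Carrier) → List (List E) → Carrier
  ieSum {E} v xs = Σ (map term (subfamilies xs))
    where
    term : List (List E) → Carrier
    term []         = 0#
    term I@(_ ∷ _)  = sign (suc (length I)) * v (concat I)

  -- Probabilistic event structure axioms on (E, ≤, #, v).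
  -- v is given on all finite subsets, with v(z) = 0 for non-configurations.
  record IsPES {E : Set} (_≤E_ _#_ : E → E → Set) (v : List E → Carrier)
               : Set (c ⊔ ℓ) where
    field
      isEventStructure : IsEventStructure _≤E_ _#_
      v-resp      : ∀ {x y} → x ⊆ y → y ⊆ x → v x ≈ v y
      v-nonconfig : ∀ {x} → ¬ IsConfig _≤E_ _#_ x → v x ≈ 0#
      v-range     : ∀ {x} → IsConfig _≤E_ _#_ x → (0# ≤ v x) × (v x ≤ 1#)
      v-empty     : v [] ≈ 1#
      v-drop      : ∀ (y : List E) (xs : List (List E)) →
                    IsConfig _≤E_ _#_ y → All (IsConfig _≤E_ _#_) xs →
                    All (y ⊆_) xs →
                    0# ≤ v y - ieSum v xs

  record PES : Set (lsuc (c ⊔ ℓ)) where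
    field
      E     : Set
      _≤E_  : E → E → Set
      _#_   : E → E → Set
      v     : List E → Carrier
      isPES : IsPES _≤E_ _#_ v

-- Probabilistic choice  P₁ ⊕_p P₂.  Events: τ = inj₁ tt, E₁ via inj₂ ∘ inj₁,
-- E₂ via inj₂ ∘ inj₂.

module Choice {c ℓ} (R : OrderedCommRing c ℓ) (P₁ P₂ : PES R)
              (p : OrderedCommRing.Carrier R) where
  open OrderedCommRing R
  module P₁ = PES P₁
  module P₂ = PES P₂

  E⊕ : Set
  E⊕ = ⊤ ⊎ (P₁.E ⊎ P₂.E)

  τ : E⊕
  τ = inj₁ tt

  _≤⊕_ : E⊕ → E⊕ → Set
  inj₁ _               ≤⊕ _                    = ⊤
  inj₂ (inj₁ a)        ≤⊕ inj₂ (inj₁ b)        = P₁._≤E_ a b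
  inj₂ (inj₂ a)        ≤⊕ inj₂ (inj₂ b)        = P₂._≤E_ a b
  inj₂ _               ≤⊕ _                    = ⊥

  _#⊕_ : E⊕ → E⊕ → Set
  inj₂ (inj₁ a) #⊕ inj₂ (inj₁ b) = P₁._#_ a b
  inj₂ (inj₂ a) #⊕ inj₂ (inj₂ b) = P₂._#_ a b
  inj₂ (inj₁ _) #⊕ inj₂ (inj₂ _) = ⊤
  inj₂ (inj₂ _) #⊕ inj₂ (inj₁ _) = ⊤
  _             #⊕ _             = ⊥

  hasτ : List E⊕ → Bool
  hasτ []             = false
  hasτ (inj₁ _ ∷ _)   = true
  hasτ (inj₂ _ ∷ xs)  = hasτ xs

  part₁ : List E⊕ → List P₁.E
  part₁ []                  = []
  part₁ (inj₂ (inj₁ a) ∷ xs) = a ∷ part₁ xs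
  part₁ (_ ∷ xs)            = part₁ xs

  part₂ : List E⊕ → List P₂.E
  part₂ []                  = []
  part₂ (inj₂ (inj₂ a) ∷ xs) = a ∷ part₂ xs
  part₂ (_ ∷ xs)            = part₂ xs

  -- v(∅) = v({τ}) = 1;  v(x) = p·v₁(x∖{τ}) or (1-p)·v₂(x∖{τ});
  -- v(z) = 0 for non-configurations (x without τ but nonempty, or x
  -- meeting both E₁ and E₂).  Non-configurations x∖{τ} ⊆ E₁ of P₁ get
  -- p·v₁(x∖{τ}) = p·0 = 0 automatically (same for P₂).
  v⊕' : Bool → List P₁.E → List P₂.E → Carrier
  v⊕' false []      []      = 1#
  v⊕' false _       _       = 0#
  v⊕' true  []      []      = 1#
  v⊕' true  (a ∷ x) []      = p * P₁.v (a ∷ x)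
  v⊕' true  []      (b ∷ y) = (1# - p) * P₂.v (b ∷ y)
  v⊕' true  (_ ∷ _) (_ ∷ _) = 0#

  v⊕ : List E⊕ → Carrier
  v⊕ x = v⊕' (hasτ x) (part₁ x) (part₂ x)

-- The valuation of P₁ ⊕_p P₂ is p·λ₁ + (1 − p)·λ₂, where λ₁ is the valuation of P₁ ⊕₁ P₂ and λ₂
-- that of P₂ ⊕₁ P₁, read through the swap of E₁ and E₂.  Each axiom on valuations survives such
-- convex combinations (for the drop condition because the inclusion–exclusion sum is linear in the
-- valuation), so it suffices to check the axioms for λ₁.  A set meeting E₂ has λ₁-value 0, and so
-- has every union containing it, so such sets drop out of the inclusion–exclusion sum; on the
-- remaining sets λ₁ is v₁ of the E₁-part, which commutes with unions.  Thus the drop condition of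
-- λ₁ reduces to that of P₁.

module Submission where

open import Defs
open import Data.Bool using (Bool; true; false; _∨_)
open import Data.Nat using (suc)
open import Data.Unit using (tt)
open import Data.Empty using (⊥-elim)
open import Data.Product using (_×_; _,_; proj₁; proj₂; ∃)
open import Data.Sum using (_⊎_; inj₁; inj₂)
open import Data.List using (List; []; _∷_; _++_; map; concat; length; filter)
open import Data.List.Properties using (map-++; map-∘; map-cong; ++-assoc; ++-identityʳ; ++-conicalˡ; ++-conicalʳ; filter-none)
open import Data.List.Relation.Unary.All as All using (All; []; _∷_)
open import Data.List.Relation.Unary.All.Properties using (all-filter; filter⁺)
  renaming (map⁺ to All-map⁺)
open import Data.List.Relation.Binary.Subset.Propositional using (_⊆_)
open import Data.List.Relation.Binary.Subset.Propositional.Properties using (map⁺)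
open import Data.List.Membership.Propositional using (_∈_)
open import Data.List.Membership.Propositional.Properties using (∈-map⁺; ∈-map⁻)
open import Data.List.Relation.Unary.Any using (here; there)
open import Data.Maybe using (nothing)
open import Function using (_∘_)
open import Relation.Nullary using (¬_; Dec; yes; no)
open import Relation.Unary using (Decidable)
open import Relation.Binary.PropositionalEquality as ≡ using (_≡_; _≢_; cong)
open import Relation.Binary.Structures using (IsTotalOrder)
import Relation.Binary.Reasoning.Setoid as SetoidReasoning
open import Tactic.RingSolver.Core.AlmostCommutativeRing using (fromCommutativeRing)
import Tactic.RingSolver.NonReflective as RingSolver

module OrderedCommRingProperties {c ℓ} (R : OrderedCommRing c ℓ) where
  open OrderedCommRing R
  open import Algebra.Properties.Ring ring using (-‿distribʳ-*; -1*x≈-x; -‿involutive)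
  open IsTotalOrder isTotalOrder public
    using (≲-respˡ-≈; ≲-respʳ-≈; total) renaming (refl to ≤-refl; trans to ≤-trans)

  InUnitInterval : Carrier → Set ℓ
  InUnitInterval a = 0# ≤ a × a ≤ 1#

  -- If 1 ≤ 0 then 0 ≤ -1, hence 0 ≤ (-1)(-1) = 1.
  0≤1 : 0# ≤ 1#
  0≤1 with total 0# 1#
  ... | inj₁ 0≤1 = 0≤1
  ... | inj₂ 1≤0 = ≲-respʳ-≈ (trans (-1*x≈-x (- 1#)) (-‿involutive 1#)) (*-nonneg 0≤-1 0≤-1)
    where
    0≤-1 : 0# ≤ - 1#
    0≤-1 = ≲-respˡ-≈ (-‿inverseʳ 1#) (≲-respʳ-≈ (+-identityˡ (- 1#)) (+-mono-≤ (- 1#) 1≤0))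

  0∈[0,1] : InUnitInterval 0#
  0∈[0,1] = ≤-refl , 0≤1

  1∈[0,1] : InUnitInterval 1#
  1∈[0,1] = 0≤1 , ≤-refl

  InUnitInterval-resp : ∀ {a b} → a ≈ b → InUnitInterval a → InUnitInterval b
  InUnitInterval-resp a≈b (0≤a , a≤1) = ≲-respʳ-≈ a≈b 0≤a , ≲-respˡ-≈ a≈b a≤1

  +-mono₂-≤ : ∀ {a b c d} → a ≤ b → c ≤ d → a + c ≤ b + d
  +-mono₂-≤ {a} {b} {c} {d} a≤b c≤d =
    ≤-trans (+-mono-≤ c a≤b)
            (≲-respˡ-≈ (+-comm c b) (≲-respʳ-≈ (+-comm d b) (+-mono-≤ b c≤d)))

  +-nonneg : ∀ {a b} → 0# ≤ a → 0# ≤ b → 0# ≤ a + b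
  +-nonneg 0≤a 0≤b = ≲-respˡ-≈ (+-identityʳ 0#) (+-mono₂-≤ 0≤a 0≤b)

  x≤y⇒0≤y-x : ∀ {x y} → x ≤ y → 0# ≤ y - x
  x≤y⇒0≤y-x {x} x≤y = ≲-respˡ-≈ (-‿inverseʳ x) (+-mono-≤ (- x) x≤y)

  y-x+x≈y : ∀ x y → (y - x) + x ≈ y
  y-x+x≈y x y = trans (+-assoc y (- x) x) (trans (+-congˡ (-‿inverseˡ x)) (+-identityʳ y))

  x+[1-x]≈1 : ∀ x → x + (1# - x) ≈ 1#
  x+[1-x]≈1 x = trans (+-comm x (1# - x)) (y-x+x≈y x 1#)

  0≤y-x⇒x≤y : ∀ {x y} → 0# ≤ y - x → x ≤ y
  0≤y-x⇒x≤y {x} {y} 0≤y-x = ≲-respˡ-≈ (+-identityˡ x) (≲-respʳ-≈ (y-x+x≈y x y) (+-mono-≤ x 0≤y-x))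

  *-distribˡ-minus : ∀ a x y → a * (x - y) ≈ a * x - a * y
  *-distribˡ-minus a x y = trans (distribˡ a x (- y)) (+-congˡ (sym (-‿distribʳ-* a y)))

  x*y≤x : ∀ {x y} → 0# ≤ x → y ≤ 1# → x * y ≤ x
  x*y≤x {x} {y} 0≤x y≤1 = 0≤y-x⇒x≤y (≲-respʳ-≈ x[1-y]≈x-xy (*-nonneg 0≤x (x≤y⇒0≤y-x y≤1)))
    where
    x[1-y]≈x-xy : x * (1# - y) ≈ x - x * y
    x[1-y]≈x-xy = trans (*-distribˡ-minus x 1# y) (+-congʳ (*-identityʳ x))

  convex-InUnitInterval : ∀ {p a b} → InUnitInterval p → InUnitInterval a → InUnitInterval b →
                          InUnitInterval (p * a + (1# - p) * b)
  convex-InUnitInterval {p} (0≤p , p≤1) (0≤a , a≤1) (0≤b , b≤1) =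
    +-nonneg (*-nonneg 0≤p 0≤a) (*-nonneg 0≤1-p 0≤b) ,
    ≲-respʳ-≈ (x+[1-x]≈1 p)
      (+-mono₂-≤ (x*y≤x 0≤p a≤1) (x*y≤x 0≤1-p b≤1))
    where
    0≤1-p : 0# ≤ 1# - p
    0≤1-p = x≤y⇒0≤y-x p≤1

module InclusionExclusion {c ℓ} (R : OrderedCommRing c ℓ) where
  open OrderedCommRing R
  open OrderedCommRingProperties R
  open SetoidReasoning setoid
  open import Algebra.Properties.Ring ring using (-‿involutive; -‿distribˡ-*; -‿+-comm; -0#≈0#)
  open RingSolver (fromCommutativeRing commRing (λ _ → nothing))
    using (solve; _⊜_; _⊕_; ⊝_)

  private
    variable
      A B : Set

  Σ-++ : ∀ as bs → Σ R (as ++ bs) ≈ Σ R as + Σ R bs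
  Σ-++ []       bs = sym (+-identityˡ (Σ R bs))
  Σ-++ (a ∷ as) bs = trans (+-congˡ (Σ-++ as bs)) (sym (+-assoc a (Σ R as) (Σ R bs)))

  Σ-map-cong : ∀ {f g : A → Carrier} → (∀ x → f x ≈ g x) → ∀ xs → Σ R (map f xs) ≈ Σ R (map g xs)
  Σ-map-cong f≈g []       = refl
  Σ-map-cong f≈g (x ∷ xs) = +-cong (f≈g x) (Σ-map-cong f≈g xs)

  Σ-map-neg : ∀ (f : A → Carrier) xs → Σ R (map (λ x → - f x) xs) ≈ - Σ R (map f xs)
  Σ-map-neg f []       = sym -0#≈0#
  Σ-map-neg f (x ∷ xs) = trans (+-congˡ (Σ-map-neg f xs)) (-‿+-comm (f x) (Σ R (map f xs)))

  Σ-subfamilies-∷ : ∀ (f : List (List A) → Carrier) x xs →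
                    Σ R (map f (subfamilies R (x ∷ xs))) ≈
                    Σ R (map f (subfamilies R xs)) + Σ R (map (f ∘ (x ∷_)) (subfamilies R xs))
  Σ-subfamilies-∷ f x xs = begin
    Σ R (map f (Js ++ map (x ∷_) Js))        ≡⟨ cong (Σ R) (map-++ f Js (map (x ∷_) Js)) ⟩
    Σ R (map f Js ++ map f (map (x ∷_) Js))  ≈⟨ Σ-++ (map f Js) (map f (map (x ∷_) Js)) ⟩
    Σ R (map f Js) + Σ R (map f (map (x ∷_) Js)) ≡⟨ cong (λ s → Σ R (map f Js) + Σ R s) (map-∘ Js) ⟨
    Σ R (map f Js) + Σ R (map (f ∘ (x ∷_)) Js) ∎
    where Js = subfamilies R xs

  ieTerm : (List A → Carrier) → List (List A) → Carrier
  ieTerm w []          = 0#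
  ieTerm w J@(_ ∷ _)   = sign R (suc (length J)) * w (concat J)

  ieSum-unfold : ∀ (w : List A → Carrier) xs → ieSum R w xs ≡ Σ R (map (ieTerm w) (subfamilies R xs))
  ieSum-unfold w xs = cong (Σ R) (map-cong (λ { [] → ≡.refl ; (_ ∷ _) → ≡.refl }) (subfamilies R xs))

  -- Unlike ieSum, this sum includes the empty subfamily, which makes its recursion (altSum-∷) uniform.
  altSum : (List A → Carrier) → List (List A) → Carrier
  altSum w xs = Σ R (map (λ J → sign R (length J) * w (concat J)) (subfamilies R xs))

  altSum-∷ : ∀ (w : List A → Carrier) x xs →
             altSum w (x ∷ xs) ≈ altSum w xs - altSum (λ z → w (x ++ z)) xs
  altSum-∷ w x xs = trans (Σ-subfamilies-∷ _ x xs) (+-congˡ (begin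
    Σ R (map (λ J → - sign R (length J) * w (x ++ concat J)) Js)
      ≈⟨ Σ-map-cong (λ J → sym (-‿distribˡ-* _ _)) Js ⟩
    Σ R (map (λ J → - (sign R (length J) * w (x ++ concat J))) Js)
      ≈⟨ Σ-map-neg _ Js ⟩
    - altSum (λ z → w (x ++ z)) xs ∎))
    where Js = subfamilies R xs

  ieSum-∷-altSum : ∀ (w : List A → Carrier) x xs →
                   ieSum R w (x ∷ xs) ≈ ieSum R w xs + altSum (λ z → w (x ++ z)) xs
  ieSum-∷-altSum w x xs = begin
    ieSum R w (x ∷ xs)
      ≡⟨ ieSum-unfold w (x ∷ xs) ⟩
    Σ R (map (ieTerm w) (subfamilies R (x ∷ xs)))
      ≈⟨ Σ-subfamilies-∷ (ieTerm w) x xs ⟩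
    Σ R (map (ieTerm w) Js) + Σ R (map (ieTerm w ∘ (x ∷_)) Js)
      ≈⟨ +-cong (reflexive (≡.sym (ieSum-unfold w xs)))
                (Σ-map-cong (λ J → *-congʳ (-‿involutive (sign R (length J)))) Js) ⟩
    ieSum R w xs + altSum (λ z → w (x ++ z)) xs ∎
    where Js = subfamilies R xs

  altSum≈w[]-ieSum : ∀ (w : List A → Carrier) xs → altSum w xs ≈ w [] - ieSum R w xs
  altSum≈w[]-ieSum w [] = begin
    1# * w [] + 0#     ≈⟨ +-identityʳ _ ⟩
    1# * w []          ≈⟨ *-identityˡ _ ⟩
    w []               ≈⟨ +-identityʳ (w []) ⟨
    w [] + 0#          ≈⟨ +-congˡ -0#≈0# ⟨
    w [] - 0#          ≈⟨ +-congˡ (-‿cong (+-identityʳ 0#)) ⟨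
    w [] - (0# + 0#)   ∎
  altSum≈w[]-ieSum w (x ∷ xs) = begin
    altSum w (x ∷ xs)                           ≈⟨ altSum-∷ w x xs ⟩
    altSum w xs - A′                            ≈⟨ +-congʳ (altSum≈w[]-ieSum w xs) ⟩
    (w [] - ieSum R w xs) - A′                  ≈⟨ solve 3 (λ W I A → ((W ⊕ (⊝ I)) ⊕ (⊝ A)) ⊜ (W ⊕ (⊝ (I ⊕ A)))) refl _ _ _ ⟩
    w [] - (ieSum R w xs + A′)                  ≈⟨ +-congˡ (-‿cong (ieSum-∷-altSum w x xs)) ⟨
    w [] - ieSum R w (x ∷ xs)                   ∎
    where A′ = altSum (λ z → w (x ++ z)) xs

  ieSum-[] : ∀ (w : List A → Carrier) → ieSum R w [] ≈ 0#
  ieSum-[] w = +-identityʳ 0#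

  ieSum-∷ : ∀ (w : List A → Carrier) x xs →
            ieSum R w (x ∷ xs) ≈ ieSum R w xs + (w x - ieSum R (λ z → w (x ++ z)) xs)
  ieSum-∷ w x xs = begin
    ieSum R w (x ∷ xs)                                        ≈⟨ ieSum-∷-altSum w x xs ⟩
    ieSum R w xs + altSum (λ z → w (x ++ z)) xs               ≈⟨ +-congˡ (altSum≈w[]-ieSum (λ z → w (x ++ z)) xs) ⟩
    ieSum R w xs + (w (x ++ []) - ieSum R (λ z → w (x ++ z)) xs)
      ≡⟨ cong (λ y → ieSum R w xs + (w y - ieSum R (λ z → w (x ++ z)) xs)) (++-identityʳ x) ⟩
    ieSum R w xs + (w x - ieSum R (λ z → w (x ++ z)) xs)      ∎

  ieSum-cong : ∀ {f g : List A → Carrier} → (∀ z → f z ≈ g z) → ∀ xs → ieSum R f xs ≈ ieSum R g xs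
  ieSum-cong {f = f} {g} f≈g []       = trans (ieSum-[] f) (sym (ieSum-[] g))
  ieSum-cong {f = f} {g} f≈g (x ∷ xs) = begin
    ieSum R f (x ∷ xs)                                   ≈⟨ ieSum-∷ f x xs ⟩
    ieSum R f xs + (f x - ieSum R (λ z → f (x ++ z)) xs)
      ≈⟨ +-cong (ieSum-cong f≈g xs) (+-cong (f≈g x) (-‿cong (ieSum-cong (λ z → f≈g (x ++ z)) xs))) ⟩
    ieSum R g xs + (g x - ieSum R (λ z → g (x ++ z)) xs) ≈⟨ ieSum-∷ g x xs ⟨
    ieSum R g (x ∷ xs)                                   ∎

  ieSum-vanishing : ∀ {w : List A → Carrier} → (∀ z → w z ≈ 0#) → ∀ xs → ieSum R w xs ≈ 0#
  ieSum-vanishing {w = w} w≈0 []       = ieSum-[] w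
  ieSum-vanishing {w = w} w≈0 (x ∷ xs) = begin
    ieSum R w (x ∷ xs)                                   ≈⟨ ieSum-∷ w x xs ⟩
    ieSum R w xs + (w x - ieSum R (λ z → w (x ++ z)) xs)
      ≈⟨ +-cong (ieSum-vanishing w≈0 xs) (+-cong (w≈0 x) (-‿cong (ieSum-vanishing (λ z → w≈0 (x ++ z)) xs))) ⟩
    0# + (0# - 0#)                                       ≈⟨ +-identityˡ _ ⟩
    0# - 0#                                              ≈⟨ -‿inverseʳ 0# ⟩
    0#                                                   ∎

  ieSum-+ : ∀ (f g : List A → Carrier) xs → ieSum R (λ z → f z + g z) xs ≈ ieSum R f xs + ieSum R g xs
  ieSum-+ f g [] = begin
    ieSum R (λ z → f z + g z) [] ≈⟨ ieSum-[] (λ z → f z + g z) ⟩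
    0#                           ≈⟨ +-identityʳ 0# ⟨
    0# + 0#                      ≈⟨ +-cong (ieSum-[] f) (ieSum-[] g) ⟨
    ieSum R f [] + ieSum R g []  ∎
  ieSum-+ f g (x ∷ xs) = begin
    ieSum R (λ z → f z + g z) (x ∷ xs)
      ≈⟨ ieSum-∷ (λ z → f z + g z) x xs ⟩
    ieSum R (λ z → f z + g z) xs + ((f x + g x) - ieSum R (λ z → f′ z + g′ z) xs)
      ≈⟨ +-cong (ieSum-+ f g xs) (+-congˡ (-‿cong (ieSum-+ f′ g′ xs))) ⟩
    (ieSum R f xs + ieSum R g xs) + ((f x + g x) - (ieSum R f′ xs + ieSum R g′ xs))
      ≈⟨ solve 6 (λ F G fx gx F′ G′ →
           ((F ⊕ G) ⊕ ((fx ⊕ gx) ⊕ (⊝ (F′ ⊕ G′)))) ⊜ ((F ⊕ (fx ⊕ (⊝ F′))) ⊕ (G ⊕ (gx ⊕ (⊝ G′)))))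
           refl _ _ (f x) (g x) _ _ ⟩
    (ieSum R f xs + (f x - ieSum R f′ xs)) + (ieSum R g xs + (g x - ieSum R g′ xs))
      ≈⟨ +-cong (ieSum-∷ f x xs) (ieSum-∷ g x xs) ⟨
    ieSum R f (x ∷ xs) + ieSum R g (x ∷ xs) ∎
    where
    f′ = λ z → f (x ++ z)
    g′ = λ z → g (x ++ z)

  ieSum-*ˡ : ∀ a (f : List A → Carrier) xs → ieSum R (λ z → a * f z) xs ≈ a * ieSum R f xs
  ieSum-*ˡ a f [] = trans (ieSum-[] (λ z → a * f z)) (sym (trans (*-congˡ (ieSum-[] f)) (zeroʳ a)))
  ieSum-*ˡ a f (x ∷ xs) = begin
    ieSum R (λ z → a * f z) (x ∷ xs)                          ≈⟨ ieSum-∷ (λ z → a * f z) x xs ⟩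
    ieSum R (λ z → a * f z) xs + (a * f x - ieSum R (λ z → a * f′ z) xs)
      ≈⟨ +-cong (ieSum-*ˡ a f xs) (+-congˡ (-‿cong (ieSum-*ˡ a f′ xs))) ⟩
    a * ieSum R f xs + (a * f x - a * ieSum R f′ xs)          ≈⟨ +-congˡ (*-distribˡ-minus a _ _) ⟨
    a * ieSum R f xs + a * (f x - ieSum R f′ xs)              ≈⟨ distribˡ a _ _ ⟨
    a * (ieSum R f xs + (f x - ieSum R f′ xs))                ≈⟨ *-congˡ (ieSum-∷ f x xs) ⟨
    a * ieSum R f (x ∷ xs)                                    ∎
    where f′ = λ z → f (x ++ z)

  ieSum-filter : ∀ {P : List A → Set} (P? : Decidable P) (w : List A → Carrier) →
                 (∀ {x} → ¬ P x → ∀ u z → w (u ++ x ++ z) ≈ 0#) →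
                 ∀ xs → ieSum R w xs ≈ ieSum R w (filter P? xs)
  ieSum-filter P? w dead [] = refl
  ieSum-filter {P = P} P? w dead (x ∷ xs) with P? x
  ... | yes _ = begin
    ieSum R w (x ∷ xs)                                                ≈⟨ ieSum-∷ w x xs ⟩
    ieSum R w xs + (w x - ieSum R w′ xs)
      ≈⟨ +-cong (ieSum-filter P? w dead xs) (+-congˡ (-‿cong (ieSum-filter P? w′ dead′ xs))) ⟩
    ieSum R w (filter P? xs) + (w x - ieSum R w′ (filter P? xs))      ≈⟨ ieSum-∷ w x (filter P? xs) ⟨
    ieSum R w (x ∷ filter P? xs)                                      ∎
    where
    w′ = λ z → w (x ++ z)
    dead′ : ∀ {y} → ¬ P y → ∀ u z → w′ (u ++ y ++ z) ≈ 0#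
    dead′ {y} ¬Py u z = trans (reflexive (cong w (≡.sym (++-assoc x u (y ++ z))))) (dead ¬Py (x ++ u) z)
  ... | no ¬Px = begin
    ieSum R w (x ∷ xs)                                                ≈⟨ ieSum-∷ w x xs ⟩
    ieSum R w xs + (w x - ieSum R (λ z → w (x ++ z)) xs)
      ≈⟨ +-congˡ (+-cong w[x]≈0 (-‿cong (ieSum-vanishing (dead ¬Px []) xs))) ⟩
    ieSum R w xs + (0# - 0#)                                          ≈⟨ +-congˡ (-‿inverseʳ 0#) ⟩
    ieSum R w xs + 0#                                                 ≈⟨ +-identityʳ _ ⟩
    ieSum R w xs                                                      ≈⟨ ieSum-filter P? w dead xs ⟩
    ieSum R w (filter P? xs)                                          ∎
    where
    w[x]≈0 : w x ≈ 0#
    w[x]≈0 = trans (reflexive (cong w (≡.sym (++-identityʳ x)))) (dead ¬Px [] [])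

  ieSum-map : ∀ {Q : List A → Set} (g : List A → List B) →
              (∀ a b → g (a ++ b) ≡ g a ++ g b) → (∀ {a b} → Q a → Q b → Q (a ++ b)) →
              ∀ {w : List A → Carrier} {u : List B → Carrier} → (∀ {x} → Q x → w x ≈ u (g x)) →
              ∀ {xs} → All Q xs → ieSum R w xs ≈ ieSum R u (map g xs)
  ieSum-map g g-++ Q-++ {w} {u} w≈u {[]} [] = trans (ieSum-[] w) (sym (ieSum-[] u))
  ieSum-map {Q = Q} g g-++ Q-++ {w} {u} w≈u {x ∷ xs} (Qx ∷ Qxs) = begin
    ieSum R w (x ∷ xs)                                          ≈⟨ ieSum-∷ w x xs ⟩
    ieSum R w xs + (w x - ieSum R (λ z → w (x ++ z)) xs)
      ≈⟨ +-cong (ieSum-map g g-++ Q-++ w≈u Qxs) (+-cong (w≈u Qx) (-‿cong (ieSum-map g g-++ Q-++ w′≈u′ Qxs))) ⟩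
    ieSum R u (map g xs) + (u (g x) - ieSum R (λ z → u (g x ++ z)) (map g xs)) ≈⟨ ieSum-∷ u (g x) (map g xs) ⟨
    ieSum R u (g x ∷ map g xs)                                  ∎
    where
    w′≈u′ : ∀ {z} → Q z → w (x ++ z) ≈ u (g x ++ g z)
    w′≈u′ {z} Qz = trans (w≈u (Q-++ Qx Qz)) (reflexive (cong u (g-++ x z)))

  DropIneq : (List A → Set) → (List A → Carrier) → Set ℓ
  DropIneq C w = ∀ y xs → C y → All C xs → All (y ⊆_) xs → 0# ≤ w y - ieSum R w xs

  DropIneq-cong : ∀ {C : List A → Set} {f g} → (∀ z → f z ≈ g z) → DropIneq C f → DropIneq C g
  DropIneq-cong f≈g drop-f y xs Cy Cxs y⊆xs =
    ≲-respʳ-≈ (+-cong (f≈g y) (-‿cong (ieSum-cong f≈g xs))) (drop-f y xs Cy Cxs y⊆xs)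

  DropIneq-linear : ∀ {C : List A → Set} {f g a b} → 0# ≤ a → 0# ≤ b →
                    DropIneq C f → DropIneq C g → DropIneq C (λ z → a * f z + b * g z)
  DropIneq-linear {f = f} {g} {a} {b} 0≤a 0≤b drop-f drop-g y xs Cy Cxs y⊆xs =
    ≲-respʳ-≈ (sym split)
      (+-nonneg (*-nonneg 0≤a (drop-f y xs Cy Cxs y⊆xs)) (*-nonneg 0≤b (drop-g y xs Cy Cxs y⊆xs)))
    where
    split : (a * f y + b * g y) - ieSum R (λ z → a * f z + b * g z) xs ≈
            a * (f y - ieSum R f xs) + b * (g y - ieSum R g xs)
    split = begin
      (a * f y + b * g y) - ieSum R (λ z → a * f z + b * g z) xs
        ≈⟨ +-congˡ (-‿cong (trans (ieSum-+ _ _ xs) (+-cong (ieSum-*ˡ a f xs) (ieSum-*ˡ b g xs)))) ⟩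
      (a * f y + b * g y) - (a * ieSum R f xs + b * ieSum R g xs)
        ≈⟨ solve 4 (λ A B C D → ((A ⊕ B) ⊕ (⊝ (C ⊕ D))) ⊜ ((A ⊕ (⊝ C)) ⊕ (B ⊕ (⊝ D)))) refl _ _ _ _ ⟩
      (a * f y - a * ieSum R f xs) + (b * g y - b * ieSum R g xs)
        ≈⟨ +-cong (*-distribˡ-minus a _ _) (*-distribˡ-minus b _ _) ⟨
      a * (f y - ieSum R f xs) + b * (g y - ieSum R g xs) ∎

  DropIneq-map : ∀ {C : List A → Set} {C′ : List B → Set} {w} (f : A → B) →
                 (∀ {x} → C x → C′ (map f x)) → DropIneq C′ w → DropIneq C (w ∘ map f)
  DropIneq-map f C⇒C′ drop y xs Cy Cxs y⊆xs =
    ≲-respʳ-≈ (+-congˡ (-‿cong (sym (ieSum-map (map f) (map-++ f) (λ _ _ → tt) (λ _ → refl)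
                                                (All.universal (λ _ → tt) xs)))))
      (drop (map f y) (map (map f) xs) (C⇒C′ Cy) (All-map⁺ (All.map C⇒C′ Cxs))
            (All-map⁺ (All.map (map⁺ f) y⊆xs)))

pattern τ = inj₁ tt
pattern ev₁ a = inj₂ (inj₁ a)
pattern ev₂ b = inj₂ (inj₂ b)

module ChoiceEventStructure {c ℓ} (R : OrderedCommRing c ℓ) (P₁ P₂ : PES R)
                            (p : OrderedCommRing.Carrier R) where
  open Choice R P₁ P₂ p hiding (τ)
  module ES₁ = IsEventStructure (IsPES.isEventStructure P₁.isPES)
  module ES₂ = IsEventStructure (IsPES.isEventStructure P₂.isPES)

  ≤⊕-refl : ∀ e → e ≤⊕ e
  ≤⊕-refl τ       = tt
  ≤⊕-refl (ev₁ a) = ES₁.≤-refl a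
  ≤⊕-refl (ev₂ b) = ES₂.≤-refl b

  ≤⊕-trans : ∀ {e e′ e″} → e ≤⊕ e′ → e′ ≤⊕ e″ → e ≤⊕ e″
  ≤⊕-trans {τ}                       _  _  = tt
  ≤⊕-trans {ev₁ _} {ev₁ _} {ev₁ _}   le le′ = ES₁.≤-trans le le′
  ≤⊕-trans {ev₂ _} {ev₂ _} {ev₂ _}   le le′ = ES₂.≤-trans le le′
  ≤⊕-trans {ev₁ _} {τ}               ()
  ≤⊕-trans {ev₁ _} {ev₂ _}           ()
  ≤⊕-trans {ev₁ _} {ev₁ _} {τ}       _  ()
  ≤⊕-trans {ev₁ _} {ev₁ _} {ev₂ _}   _  ()
  ≤⊕-trans {ev₂ _} {τ}               ()
  ≤⊕-trans {ev₂ _} {ev₁ _}           ()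
  ≤⊕-trans {ev₂ _} {ev₂ _} {τ}       _  ()
  ≤⊕-trans {ev₂ _} {ev₂ _} {ev₁ _}   _  ()

  ≤⊕-antisym : ∀ {e e′} → e ≤⊕ e′ → e′ ≤⊕ e → e ≡ e′
  ≤⊕-antisym {τ}     {τ}     _  _   = ≡.refl
  ≤⊕-antisym {ev₁ _} {ev₁ _} le le′ = cong (λ a → ev₁ a) (ES₁.≤-antisym le le′)
  ≤⊕-antisym {ev₂ _} {ev₂ _} le le′ = cong (λ b → ev₂ b) (ES₂.≤-antisym le le′)
  ≤⊕-antisym {τ}     {ev₁ _} _  ()
  ≤⊕-antisym {τ}     {ev₂ _} _  ()
  ≤⊕-antisym {ev₁ _} {τ}     ()
  ≤⊕-antisym {ev₁ _} {ev₂ _} ()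
  ≤⊕-antisym {ev₂ _} {τ}     ()
  ≤⊕-antisym {ev₂ _} {ev₁ _} ()

  #⊕-irrefl : ∀ e → ¬ (e #⊕ e)
  #⊕-irrefl τ       ()
  #⊕-irrefl (ev₁ a) = ES₁.#-irrefl a
  #⊕-irrefl (ev₂ b) = ES₂.#-irrefl b

  #⊕-sym : ∀ {e e′} → e #⊕ e′ → e′ #⊕ e
  #⊕-sym {ev₁ _} {ev₁ _} c = ES₁.#-sym c
  #⊕-sym {ev₂ _} {ev₂ _} c = ES₂.#-sym c
  #⊕-sym {ev₁ _} {ev₂ _} _ = tt
  #⊕-sym {ev₂ _} {ev₁ _} _ = tt
  #⊕-sym {τ}             ()
  #⊕-sym {ev₁ _} {τ}     ()
  #⊕-sym {ev₂ _} {τ}     ()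

  #⊕-her : ∀ {e e′ e″} → e #⊕ e′ → e′ ≤⊕ e″ → e #⊕ e″
  #⊕-her {ev₁ _} {ev₁ _} {ev₁ _} c le = ES₁.#-her c le
  #⊕-her {ev₂ _} {ev₂ _} {ev₂ _} c le = ES₂.#-her c le
  #⊕-her {ev₁ _} {ev₂ _} {ev₂ _} _ _  = tt
  #⊕-her {ev₂ _} {ev₁ _} {ev₁ _} _ _  = tt
  #⊕-her {τ}                     ()
  #⊕-her {ev₁ _} {τ}             ()
  #⊕-her {ev₂ _} {τ}             ()
  #⊕-her {ev₁ _} {ev₁ _} {τ}     _ ()
  #⊕-her {ev₁ _} {ev₁ _} {ev₂ _} _ ()
  #⊕-her {ev₂ _} {ev₂ _} {τ}     _ ()
  #⊕-her {ev₂ _} {ev₂ _} {ev₁ _} _ ()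
  #⊕-her {ev₁ _} {ev₂ _} {τ}     _ ()
  #⊕-her {ev₁ _} {ev₂ _} {ev₁ _} _ ()
  #⊕-her {ev₂ _} {ev₁ _} {τ}     _ ()
  #⊕-her {ev₂ _} {ev₁ _} {ev₂ _} _ ()

  down⊕ : E⊕ → List E⊕
  down⊕ τ       = τ ∷ []
  down⊕ (ev₁ a) = τ ∷ map (λ a′ → ev₁ a′) (ES₁.down a)
  down⊕ (ev₂ b) = τ ∷ map (λ b′ → ev₂ b′) (ES₂.down b)

  down⊕-sound : ∀ {e e′} → e′ ∈ down⊕ e → e′ ≤⊕ e
  down⊕-sound {τ}     (here ≡.refl) = tt
  down⊕-sound {ev₁ _} (here ≡.refl) = tt
  down⊕-sound {ev₂ _} (here ≡.refl) = tt
  down⊕-sound {ev₁ _} (there e′∈) with ∈-map⁻ (λ a′ → ev₁ a′) e′∈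
  ... | _ , a′∈ , ≡.refl = ES₁.down-sound a′∈
  down⊕-sound {ev₂ _} (there e′∈) with ∈-map⁻ (λ b′ → ev₂ b′) e′∈
  ... | _ , b′∈ , ≡.refl = ES₂.down-sound b′∈

  down⊕-complete : ∀ {e e′} → e′ ≤⊕ e → e′ ∈ down⊕ e
  down⊕-complete {τ}     {τ}     _  = here ≡.refl
  down⊕-complete {ev₁ _} {τ}     _  = here ≡.refl
  down⊕-complete {ev₂ _} {τ}     _  = here ≡.refl
  down⊕-complete {ev₁ _} {ev₁ _} le = there (∈-map⁺ (λ a′ → ev₁ a′) (ES₁.down-complete le))
  down⊕-complete {ev₂ _} {ev₂ _} le = there (∈-map⁺ (λ b′ → ev₂ b′) (ES₂.down-complete le))
  down⊕-complete {τ}     {ev₁ _} ()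
  down⊕-complete {τ}     {ev₂ _} ()
  down⊕-complete {ev₂ _} {ev₁ _} ()
  down⊕-complete {ev₁ _} {ev₂ _} ()

  isEventStructure : IsEventStructure _≤⊕_ _#⊕_
  isEventStructure = record
    { ≤-refl        = ≤⊕-refl
    ; ≤-trans       = λ {e e′ e″} → ≤⊕-trans {e} {e′} {e″}
    ; ≤-antisym     = ≤⊕-antisym
    ; #-irrefl      = #⊕-irrefl
    ; #-sym         = λ {e e′} → #⊕-sym {e} {e′}
    ; #-her         = λ {e e′ e″} → #⊕-her {e} {e′} {e″}
    ; down          = down⊕
    ; down-sound    = down⊕-sound
    ; down-complete = down⊕-complete
    }

⊈[] : ∀ {A : Set} {a : A} {as} → ¬ (a ∷ as ⊆ [])
⊈[] a∷as⊆[] with a∷as⊆[] (here ≡.refl)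
... | ()

⊆[]⇒≡[] : ∀ {A : Set} {as : List A} → as ⊆ [] → as ≡ []
⊆[]⇒≡[] {as = []}    _      = ≡.refl
⊆[]⇒≡[] {as = _ ∷ _} as⊆[] = ⊥-elim (⊈[] as⊆[])

≡[]? : ∀ {A : Set} (as : List A) → Dec (as ≡ [])
≡[]? []      = yes ≡.refl
≡[]? (_ ∷ _) = no (λ ())

IsConfig-map : ∀ {A B : Set} {_≤A_ _#A_ : A → A → Set} {_≤B_ _#B_ : B → B → Set} (f : A → B) →
               (∀ {a a′} → f a #B f a′ → a #A a′) →
               (∀ {b a} → b ≤B f a → ∃ λ a′ → a′ ≤A a × f a′ ≡ b) →
               ∀ {x} → IsConfig _≤A_ _#A_ x → IsConfig _≤B_ _#B_ (map f x)
IsConfig-map {_≤B_ = _≤B_} {_#B_} f f-reflects-# f-lifts-≤ {x} (conflictFree , closed) =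
  conflictFree′ , closed′
  where
  conflictFree′ : ∀ {b b′} → b ∈ map f x → b′ ∈ map f x → ¬ (b #B b′)
  conflictFree′ b∈ b′∈ with ∈-map⁻ f b∈ | ∈-map⁻ f b′∈
  ... | _ , a∈ , ≡.refl | _ , a′∈ , ≡.refl = conflictFree a∈ a′∈ ∘ f-reflects-#

  closed′ : ∀ {b b′} → b′ ≤B b → b ∈ map f x → b′ ∈ map f x
  closed′ b′≤b b∈ with ∈-map⁻ f b∈
  ... | _ , a∈ , ≡.refl with f-lifts-≤ b′≤b
  ...   | _ , a′≤a , ≡.refl = ∈-map⁺ f (closed a′≤a a∈)

module ChoiceConfigurations {c ℓ} (R : OrderedCommRing c ℓ) (P₁ P₂ : PES R)
                            (p : OrderedCommRing.Carrier R) where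
  open Choice R P₁ P₂ p hiding (τ)

  Cfg : List E⊕ → Set
  Cfg = IsConfig _≤⊕_ _#⊕_

  Cfg₁ : List P₁.E → Set
  Cfg₁ = IsConfig P₁._≤E_ P₁._#_

  cfg-[] : Cfg []
  cfg-[] = (λ ()) , (λ _ ())

  hasτ⇒τ∈ : ∀ {x} → hasτ x ≡ true → τ ∈ x
  hasτ⇒τ∈ {τ ∷ _}     _ = here ≡.refl
  hasτ⇒τ∈ {ev₁ _ ∷ x} h = there (hasτ⇒τ∈ h)
  hasτ⇒τ∈ {ev₂ _ ∷ x} h = there (hasτ⇒τ∈ h)

  τ∈⇒hasτ : ∀ {x} → τ ∈ x → hasτ x ≡ true
  τ∈⇒hasτ (here ≡.refl)          = ≡.refl
  τ∈⇒hasτ {τ ∷ _}     (there _)  = ≡.refl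
  τ∈⇒hasτ {ev₁ _ ∷ _} (there τ∈) = τ∈⇒hasτ τ∈
  τ∈⇒hasτ {ev₂ _ ∷ _} (there τ∈) = τ∈⇒hasτ τ∈

  hasτ-resp : ∀ {x y} → x ⊆ y → y ⊆ x → hasτ x ≡ hasτ y
  hasτ-resp {x} {y} x⊆y y⊆x with hasτ x in hx | hasτ y in hy
  ... | false | false = ≡.refl
  ... | true  | true  = ≡.refl
  ... | false | true  = ≡.trans (≡.sym hx) (τ∈⇒hasτ (y⊆x (hasτ⇒τ∈ hy)))
  ... | true  | false = ≡.trans (≡.sym (τ∈⇒hasτ (x⊆y (hasτ⇒τ∈ hx)))) hy

  hasτ-++ : ∀ x y → hasτ (x ++ y) ≡ hasτ x ∨ hasτ y
  hasτ-++ []          y = ≡.refl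
  hasτ-++ (τ ∷ x)     y = ≡.refl
  hasτ-++ (ev₁ _ ∷ x) y = hasτ-++ x y
  hasτ-++ (ev₂ _ ∷ x) y = hasτ-++ x y

  part₁-++ : ∀ x y → part₁ (x ++ y) ≡ part₁ x ++ part₁ y
  part₁-++ []          y = ≡.refl
  part₁-++ (τ ∷ x)     y = part₁-++ x y
  part₁-++ (ev₁ a ∷ x) y = cong (a ∷_) (part₁-++ x y)
  part₁-++ (ev₂ _ ∷ x) y = part₁-++ x y

  part₂-++ : ∀ x y → part₂ (x ++ y) ≡ part₂ x ++ part₂ y
  part₂-++ []          y = ≡.refl
  part₂-++ (τ ∷ x)     y = part₂-++ x y
  part₂-++ (ev₁ _ ∷ x) y = part₂-++ x y
  part₂-++ (ev₂ b ∷ x) y = cong (b ∷_) (part₂-++ x y)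

  ∈-part₁⁺ : ∀ {a x} → ev₁ a ∈ x → a ∈ part₁ x
  ∈-part₁⁺ {x = ev₁ _ ∷ _} (here ≡.refl) = here ≡.refl
  ∈-part₁⁺ {x = τ ∷ _}     (there a∈)    = ∈-part₁⁺ a∈
  ∈-part₁⁺ {x = ev₁ _ ∷ _} (there a∈)    = there (∈-part₁⁺ a∈)
  ∈-part₁⁺ {x = ev₂ _ ∷ _} (there a∈)    = ∈-part₁⁺ a∈

  ∈-part₁⁻ : ∀ {a x} → a ∈ part₁ x → ev₁ a ∈ x
  ∈-part₁⁻ {x = τ ∷ _}     a∈            = there (∈-part₁⁻ a∈)
  ∈-part₁⁻ {x = ev₁ _ ∷ _} (here ≡.refl) = here ≡.refl
  ∈-part₁⁻ {x = ev₁ _ ∷ _} (there a∈)    = there (∈-part₁⁻ a∈)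
  ∈-part₁⁻ {x = ev₂ _ ∷ _} a∈            = there (∈-part₁⁻ a∈)

  ∈-part₂⁺ : ∀ {b x} → ev₂ b ∈ x → b ∈ part₂ x
  ∈-part₂⁺ {x = ev₂ _ ∷ _} (here ≡.refl) = here ≡.refl
  ∈-part₂⁺ {x = τ ∷ _}     (there b∈)    = ∈-part₂⁺ b∈
  ∈-part₂⁺ {x = ev₁ _ ∷ _} (there b∈)    = ∈-part₂⁺ b∈
  ∈-part₂⁺ {x = ev₂ _ ∷ _} (there b∈)    = there (∈-part₂⁺ b∈)

  ∈-part₂⁻ : ∀ {b x} → b ∈ part₂ x → ev₂ b ∈ x
  ∈-part₂⁻ {x = τ ∷ _}     b∈            = there (∈-part₂⁻ b∈)
  ∈-part₂⁻ {x = ev₁ _ ∷ _} b∈            = there (∈-part₂⁻ b∈)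
  ∈-part₂⁻ {x = ev₂ _ ∷ _} (here ≡.refl) = here ≡.refl
  ∈-part₂⁻ {x = ev₂ _ ∷ _} (there b∈)    = there (∈-part₂⁻ b∈)

  part₁-mono : ∀ {x y} → x ⊆ y → part₁ x ⊆ part₁ y
  part₁-mono x⊆y = ∈-part₁⁺ ∘ x⊆y ∘ ∈-part₁⁻

  part₂-mono : ∀ {x y} → x ⊆ y → part₂ x ⊆ part₂ y
  part₂-mono x⊆y = ∈-part₂⁺ ∘ x⊆y ∘ ∈-part₂⁻

  part₂-infix-≡[] : ∀ u x z → part₂ (u ++ x ++ z) ≡ [] → part₂ x ≡ []
  part₂-infix-≡[] u x z e = ++-conicalˡ (part₂ x) (part₂ z)
    (≡.trans (≡.sym (part₂-++ x z)) (++-conicalʳ (part₂ u) _ (≡.trans (≡.sym (part₂-++ u (x ++ z))) e)))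

  no-events-≡[] : ∀ {x} → hasτ x ≡ false → part₁ x ≡ [] → part₂ x ≡ [] → x ≡ []
  no-events-≡[] {[]} _ _ _ = ≡.refl
  no-events-≡[] {τ ∷ _}     ()
  no-events-≡[] {ev₁ _ ∷ _} _ ()
  no-events-≡[] {ev₂ _ ∷ _} _ _ ()

  Rooted : List E⊕ → Set
  Rooted x = x ≡ [] ⊎ hasτ x ≡ true

  Rooted-++ : ∀ {x y} → Rooted x → Rooted y → Rooted (x ++ y)
  Rooted-++ (inj₁ ≡.refl) Ry = Ry
  Rooted-++ {x} {y} (inj₂ hx) _ = inj₂ (≡.trans (hasτ-++ x y) (cong (_∨ hasτ y) hx))

  cfg-rooted : ∀ {x} → Cfg x → Rooted x
  cfg-rooted {[]}    _            = inj₁ ≡.refl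
  cfg-rooted {e ∷ _} (_ , closed) = inj₂ (τ∈⇒hasτ (closed {e} {τ} tt (here ≡.refl)))

  cfg⇒cfg₁ : ∀ {x} → Cfg x → Cfg₁ (part₁ x)
  cfg⇒cfg₁ (conflictFree , closed) =
    (λ a∈ a′∈ → conflictFree (∈-part₁⁻ a∈) (∈-part₁⁻ a′∈)) ,
    (λ {a} {a′} a′≤a a∈ → ∈-part₁⁺ (closed {ev₁ a} {ev₁ a′} a′≤a (∈-part₁⁻ a∈)))

  cfg₁⇒cfg : ∀ {x} → hasτ x ≡ true → part₂ x ≡ [] → Cfg₁ (part₁ x) → Cfg x
  cfg₁⇒cfg {x} hx x∩E₂≡∅ (conflictFree₁ , closed₁) = conflictFree , closed
    where
    ∉E₂ : ∀ {b} → ¬ (ev₂ b ∈ x)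
    ∉E₂ b∈ with ≡.subst (_ ∈_) x∩E₂≡∅ (∈-part₂⁺ b∈)
    ... | ()

    conflictFree : ∀ {d d′} → d ∈ x → d′ ∈ x → ¬ (d #⊕ d′)
    conflictFree {ev₁ _} {ev₁ _} a∈ a′∈ = conflictFree₁ (∈-part₁⁺ a∈) (∈-part₁⁺ a′∈)
    conflictFree {ev₁ _} {ev₂ _} _  b∈  = λ _ → ∉E₂ b∈
    conflictFree {ev₂ _}         b∈ _   = λ _ → ∉E₂ b∈
    conflictFree {τ}             _  _   = λ ()
    conflictFree {ev₁ _} {τ}     _  _   = λ ()

    closed : ∀ {d d′} → d′ ≤⊕ d → d ∈ x → d′ ∈ x
    closed {_}     {τ}     _    _  = hasτ⇒τ∈ hx
    closed {ev₁ _} {ev₁ _} a′≤a a∈ = ∈-part₁⁻ (closed₁ a′≤a (∈-part₁⁺ a∈))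
    closed {ev₂ _} {ev₂ _} _    b∈ = ⊥-elim (∉E₂ b∈)
    closed {τ}     {ev₁ _} ()
    closed {τ}     {ev₂ _} ()
    closed {ev₁ _} {ev₂ _} ()
    closed {ev₂ _} {ev₁ _} ()

module LeftLift {c ℓ} (R : OrderedCommRing c ℓ) (P₁ P₂ : PES R)
                (p : OrderedCommRing.Carrier R) where
  open OrderedCommRing R
  open OrderedCommRingProperties R
  open InclusionExclusion R
  open Choice R P₁ P₂ p hiding (τ)
  open ChoiceConfigurations R P₁ P₂ p
  module V₁ = IsPES P₁.isPES
  open SetoidReasoning setoid

  -- The valuation of P₁ ⊕₁ P₂, the choice with p = 1.
  lift′ : List P₂.E → Bool → List P₁.E → Carrier
  lift′ (_ ∷ _) _     _       = 0#
  lift′ []      true  l       = P₁.v l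
  lift′ []      false []      = 1#
  lift′ []      false (_ ∷ _) = 0#

  lift : List E⊕ → Carrier
  lift x = lift′ (part₂ x) (hasτ x) (part₁ x)

  lift-rooted : ∀ {x} → part₂ x ≡ [] → Rooted x → lift x ≈ P₁.v (part₁ x)
  lift-rooted _ (inj₁ ≡.refl) = sym V₁.v-empty
  lift-rooted {x} x∩E₂≡∅ (inj₂ hx) rewrite x∩E₂≡∅ | hx = refl

  lift-foreign : ∀ x → part₂ x ≢ [] → lift x ≈ 0#
  lift-foreign x x∩E₂≢∅ with part₂ x
  ... | []    = ⊥-elim (x∩E₂≢∅ ≡.refl)
  ... | _ ∷ _ = refl

  lift′-resp : ∀ {l₂ l₂′} → l₂ ⊆ l₂′ → l₂′ ⊆ l₂ → ∀ b {l₁ l₁′} → l₁ ⊆ l₁′ → l₁′ ⊆ l₁ →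
               lift′ l₂ b l₁ ≈ lift′ l₂′ b l₁′
  lift′-resp {_ ∷ _} {_ ∷ _} _   _   _     _   _   = refl
  lift′-resp {[]}    {_ ∷ _} _   ⊆[] _     _   _   = ⊥-elim (⊈[] ⊆[])
  lift′-resp {_ ∷ _} {[]}    ⊆[] _   _     _   _   = ⊥-elim (⊈[] ⊆[])
  lift′-resp {[]}    {[]}    _   _   true  ⊆′  ⊇′  = V₁.v-resp ⊆′ ⊇′
  lift′-resp {[]}    {[]}    _   _   false {[]}    {[]}    _   _   = refl
  lift′-resp {[]}    {[]}    _   _   false {_ ∷ _} {_ ∷ _} _   _   = refl
  lift′-resp {[]}    {[]}    _   _   false {[]}    {_ ∷ _} _   ⊆[] = ⊥-elim (⊈[] ⊆[])
  lift′-resp {[]}    {[]}    _   _   false {_ ∷ _} {[]}    ⊆[] _   = ⊥-elim (⊈[] ⊆[])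

  lift-resp : ∀ {x y} → x ⊆ y → y ⊆ x → lift x ≈ lift y
  lift-resp {x} {y} x⊆y y⊆x rewrite hasτ-resp x⊆y y⊆x =
    lift′-resp (part₂-mono x⊆y) (part₂-mono y⊆x) (hasτ y) (part₁-mono x⊆y) (part₁-mono y⊆x)

  lift-nonconfig : ∀ {x} → ¬ Cfg x → lift x ≈ 0#
  lift-nonconfig {x} ¬Cx with part₂ x in x∩E₂ | hasτ x in hx | part₁ x in x∩E₁
  ... | _ ∷ _ | _     | _     = refl
  ... | []    | true  | _     = V₁.v-nonconfig (λ C₁ → ¬Cx (cfg₁⇒cfg hx x∩E₂ (≡.subst Cfg₁ (≡.sym x∩E₁) C₁)))
  ... | []    | false | []    = ⊥-elim (¬Cx (≡.subst Cfg (≡.sym (no-events-≡[] hx x∩E₁ x∩E₂)) cfg-[]))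
  ... | []    | false | _ ∷ _ = refl

  lift′-range : ∀ l₂ b {l₁} → Cfg₁ l₁ → InUnitInterval (lift′ l₂ b l₁)
  lift′-range (_ ∷ _) _             _  = 0∈[0,1]
  lift′-range []      true          C₁ = V₁.v-range C₁
  lift′-range []      false {[]}    _  = 1∈[0,1]
  lift′-range []      false {_ ∷ _} _  = 0∈[0,1]

  lift-range : ∀ {x} → Cfg x → InUnitInterval (lift x)
  lift-range {x} Cx = lift′-range (part₂ x) (hasτ x) (cfg⇒cfg₁ Cx)

  E₂-free? : Decidable (λ x → part₂ x ≡ [])
  E₂-free? x = ≡[]? (part₂ x)

  lift-foreign-infix : ∀ {x} → part₂ x ≢ [] → ∀ u z → lift (u ++ x ++ z) ≈ 0#
  lift-foreign-infix {x} x∩E₂≢∅ u z = lift-foreign (u ++ x ++ z) (x∩E₂≢∅ ∘ part₂-infix-≡[] u x z)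

  E₂-free-rooted-++ : ∀ {x y} → part₂ x ≡ [] × Rooted x → part₂ y ≡ [] × Rooted y →
                      part₂ (x ++ y) ≡ [] × Rooted (x ++ y)
  E₂-free-rooted-++ {x} {y} (x∩E₂≡∅ , Rx) (y∩E₂≡∅ , Ry) =
    ≡.trans (part₂-++ x y) (≡.cong₂ _++_ x∩E₂≡∅ y∩E₂≡∅) , Rooted-++ Rx Ry

  ieSum-lift : ∀ {xs} → All Cfg xs → ieSum R lift xs ≈ ieSum R P₁.v (map part₁ (filter E₂-free? xs))
  ieSum-lift {xs} Cxs = trans (ieSum-filter E₂-free? lift lift-foreign-infix xs)
    (ieSum-map part₁ part₁-++ E₂-free-rooted-++ (λ (x∩E₂≡∅ , Rx) → lift-rooted x∩E₂≡∅ Rx)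
               (All.zip (all-filter E₂-free? xs , All.map cfg-rooted (filter⁺ E₂-free? Cxs))))

  lift-drop : DropIneq Cfg lift
  lift-drop y xs Cy Cxs y⊆xs with ≡[]? (part₂ y)
  ... | yes y∩E₂≡∅ =
    ≲-respʳ-≈ (sym (+-cong (lift-rooted y∩E₂≡∅ (cfg-rooted Cy)) (-‿cong (ieSum-lift Cxs))))
      (V₁.v-drop (part₁ y) (map part₁ (filter E₂-free? xs)) (cfg⇒cfg₁ Cy)
                 (All-map⁺ (All.map cfg⇒cfg₁ (filter⁺ E₂-free? Cxs)))
                 (All-map⁺ (All.map part₁-mono (filter⁺ E₂-free? y⊆xs))))
  ... | no y∩E₂≢∅ = ≲-respʳ-≈ (sym lift-y-ieSum≈0) ≤-refl
    where
    superset-meets-E₂ : ∀ {x} → y ⊆ x → part₂ x ≢ []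
    superset-meets-E₂ y⊆x x∩E₂≡∅ = y∩E₂≢∅ (⊆[]⇒≡[] (≡.subst (part₂ y ⊆_) x∩E₂≡∅ (part₂-mono y⊆x)))

    lift-y-ieSum≈0 : lift y - ieSum R lift xs ≈ 0#
    lift-y-ieSum≈0 = begin
      lift y - ieSum R lift xs
        ≈⟨ +-cong (lift-foreign y y∩E₂≢∅) (-‿cong (ieSum-lift Cxs)) ⟩
      0# - ieSum R P₁.v (map part₁ (filter E₂-free? xs))
        ≡⟨ cong (λ ys → 0# - ieSum R P₁.v (map part₁ ys)) (filter-none E₂-free? (All.map superset-meets-E₂ y⊆xs)) ⟩
      0# - ieSum R P₁.v []
        ≈⟨ +-congˡ (-‿cong (ieSum-[] P₁.v)) ⟩
      0# - 0#
        ≈⟨ -‿inverseʳ 0# ⟩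
      0# ∎

module Swap {c ℓ} (R : OrderedCommRing c ℓ) (P₁ P₂ : PES R)
            (p : OrderedCommRing.Carrier R) where
  module ⊕₁₂ = Choice R P₁ P₂ p
  module ⊕₂₁ = Choice R P₂ P₁ p

  swapₑ : ⊕₁₂.E⊕ → ⊕₂₁.E⊕
  swapₑ τ       = τ
  swapₑ (ev₁ a) = ev₂ a
  swapₑ (ev₂ b) = ev₁ b

  hasτ-swap : ∀ x → ⊕₂₁.hasτ (map swapₑ x) ≡ ⊕₁₂.hasτ x
  hasτ-swap []          = ≡.refl
  hasτ-swap (τ ∷ x)     = ≡.refl
  hasτ-swap (ev₁ _ ∷ x) = hasτ-swap x
  hasτ-swap (ev₂ _ ∷ x) = hasτ-swap x

  part₁-swap : ∀ x → ⊕₂₁.part₁ (map swapₑ x) ≡ ⊕₁₂.part₂ x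
  part₁-swap []          = ≡.refl
  part₁-swap (τ ∷ x)     = part₁-swap x
  part₁-swap (ev₁ _ ∷ x) = part₁-swap x
  part₁-swap (ev₂ b ∷ x) = cong (b ∷_) (part₁-swap x)

  part₂-swap : ∀ x → ⊕₂₁.part₂ (map swapₑ x) ≡ ⊕₁₂.part₁ x
  part₂-swap []          = ≡.refl
  part₂-swap (τ ∷ x)     = part₂-swap x
  part₂-swap (ev₁ a ∷ x) = cong (a ∷_) (part₂-swap x)
  part₂-swap (ev₂ _ ∷ x) = part₂-swap x

  swap-reflects-# : ∀ {e e′} → swapₑ e ⊕₂₁.#⊕ swapₑ e′ → e ⊕₁₂.#⊕ e′
  swap-reflects-# {ev₁ _} {ev₁ _} c = c
  swap-reflects-# {ev₂ _} {ev₂ _} c = c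
  swap-reflects-# {ev₁ _} {ev₂ _} _ = tt
  swap-reflects-# {ev₂ _} {ev₁ _} _ = tt
  swap-reflects-# {τ}             ()
  swap-reflects-# {ev₁ _} {τ}     ()
  swap-reflects-# {ev₂ _} {τ}     ()

  swap-lifts-≤ : ∀ {d e} → d ⊕₂₁.≤⊕ swapₑ e → ∃ λ e′ → e′ ⊕₁₂.≤⊕ e × swapₑ e′ ≡ d
  swap-lifts-≤ {τ}                 _  = τ , tt , ≡.refl
  swap-lifts-≤ {ev₁ b} {ev₂ _}     le = ev₂ b , le , ≡.refl
  swap-lifts-≤ {ev₂ a} {ev₁ _}     le = ev₁ a , le , ≡.refl
  swap-lifts-≤ {ev₁ _} {τ}         ()
  swap-lifts-≤ {ev₁ _} {ev₁ _}     ()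
  swap-lifts-≤ {ev₂ _} {τ}         ()
  swap-lifts-≤ {ev₂ _} {ev₂ _}     ()

  swap-cfg : ∀ {x} → IsConfig ⊕₁₂._≤⊕_ ⊕₁₂._#⊕_ x → IsConfig ⊕₂₁._≤⊕_ ⊕₂₁._#⊕_ (map swapₑ x)
  swap-cfg = IsConfig-map swapₑ (λ {e e′} → swap-reflects-# {e} {e′}) swap-lifts-≤

module ChoiceIsPES {c ℓ} (R : OrderedCommRing c ℓ) (P₁ P₂ : PES R) (p : OrderedCommRing.Carrier R)
                   (p∈[0,1] : OrderedCommRingProperties.InUnitInterval R p) where
  open OrderedCommRing R
  open OrderedCommRingProperties R
  open InclusionExclusion R
  open Choice R P₁ P₂ p hiding (τ)
  open ChoiceConfigurations R P₁ P₂ p using (Cfg)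
  open Swap R P₁ P₂ p
  module L₁₂ = LeftLift R P₁ P₂ p
  module L₂₁ = LeftLift R P₂ P₁ p
  module V₁ = IsPES P₁.isPES
  module V₂ = IsPES P₂.isPES
  open SetoidReasoning setoid

  q : Carrier
  q = 1# - p

  lift₂ : List E⊕ → Carrier
  lift₂ = L₂₁.lift ∘ map swapₑ

  swap-involutive : ∀ x → map (Swap.swapₑ R P₂ P₁ p) (map swapₑ x) ≡ x
  swap-involutive []          = ≡.refl
  swap-involutive (τ ∷ x)     = cong (τ ∷_) (swap-involutive x)
  swap-involutive (ev₁ a ∷ x) = cong (ev₁ a ∷_) (swap-involutive x)
  swap-involutive (ev₂ b ∷ x) = cong (ev₂ b ∷_) (swap-involutive x)

  0≈p*0+q*0 : 0# ≈ p * 0# + q * 0#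
  0≈p*0+q*0 = sym (trans (+-cong (zeroʳ p) (zeroʳ q)) (+-identityʳ 0#))

  1≈p*a+q*b : ∀ {a b} → a ≈ 1# → b ≈ 1# → 1# ≈ p * a + q * b
  1≈p*a+q*b a≈1 b≈1 =
    sym (trans (+-cong (trans (*-congˡ a≈1) (*-identityʳ p)) (trans (*-congˡ b≈1) (*-identityʳ q)))
               (x+[1-x]≈1 p))

  v⊕′-decomposition : ∀ b l₁ l₂ → v⊕' b l₁ l₂ ≈ p * L₁₂.lift′ l₂ b l₁ + q * L₂₁.lift′ l₁ b l₂
  v⊕′-decomposition false []      []      = 1≈p*a+q*b refl refl
  v⊕′-decomposition false []      (_ ∷ _) = 0≈p*0+q*0
  v⊕′-decomposition false (_ ∷ _) []      = 0≈p*0+q*0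
  v⊕′-decomposition false (_ ∷ _) (_ ∷ _) = 0≈p*0+q*0
  v⊕′-decomposition true  []      []      = 1≈p*a+q*b V₁.v-empty V₂.v-empty
  v⊕′-decomposition true  (_ ∷ _) []      = sym (trans (+-congˡ (zeroʳ q)) (+-identityʳ _))
  v⊕′-decomposition true  []      (_ ∷ _) = sym (trans (+-congʳ (zeroʳ p)) (+-identityˡ _))
  v⊕′-decomposition true  (_ ∷ _) (_ ∷ _) = 0≈p*0+q*0

  v⊕-decomposition : ∀ x → v⊕ x ≈ p * L₁₂.lift x + q * lift₂ x
  v⊕-decomposition x rewrite hasτ-swap x | part₁-swap x | part₂-swap x =
    v⊕′-decomposition (hasτ x) (part₁ x) (part₂ x)

  v⊕-resp : ∀ {x y} → x ⊆ y → y ⊆ x → v⊕ x ≈ v⊕ y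
  v⊕-resp {x} {y} x⊆y y⊆x = begin
    v⊕ x                             ≈⟨ v⊕-decomposition x ⟩
    p * L₁₂.lift x + q * lift₂ x     ≈⟨ +-cong (*-congˡ (L₁₂.lift-resp x⊆y y⊆x))
                                               (*-congˡ (L₂₁.lift-resp (map⁺ swapₑ x⊆y) (map⁺ swapₑ y⊆x))) ⟩
    p * L₁₂.lift y + q * lift₂ y     ≈⟨ v⊕-decomposition y ⟨
    v⊕ y                             ∎

  v⊕-nonconfig : ∀ {x} → ¬ Cfg x → v⊕ x ≈ 0#
  v⊕-nonconfig {x} ¬Cx = begin
    v⊕ x                             ≈⟨ v⊕-decomposition x ⟩
    p * L₁₂.lift x + q * lift₂ x     ≈⟨ +-cong (*-congˡ (L₁₂.lift-nonconfig ¬Cx)) (*-congˡ (L₂₁.lift-nonconfig ¬Cx′)) ⟩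
    p * 0# + q * 0#                  ≈⟨ 0≈p*0+q*0 ⟨
    0#                               ∎
    where
    ¬Cx′ : ¬ IsConfig ⊕₂₁._≤⊕_ ⊕₂₁._#⊕_ (map swapₑ x)
    ¬Cx′ C′ = ¬Cx (≡.subst Cfg (swap-involutive x) (Swap.swap-cfg R P₂ P₁ p C′))

  v⊕-range : ∀ {x} → Cfg x → InUnitInterval (v⊕ x)
  v⊕-range {x} Cx = InUnitInterval-resp (sym (v⊕-decomposition x))
    (convex-InUnitInterval p∈[0,1] (L₁₂.lift-range Cx) (L₂₁.lift-range (swap-cfg Cx)))

  v⊕-drop : DropIneq Cfg v⊕
  v⊕-drop = DropIneq-cong (sym ∘ v⊕-decomposition)
    (DropIneq-linear (proj₁ p∈[0,1]) (x≤y⇒0≤y-x (proj₂ p∈[0,1]))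
      L₁₂.lift-drop (DropIneq-map swapₑ swap-cfg L₂₁.lift-drop))

  isPES : IsPES R _≤⊕_ _#⊕_ v⊕
  isPES = record
    { isEventStructure = ChoiceEventStructure.isEventStructure R P₁ P₂ p
    ; v-resp           = v⊕-resp
    ; v-nonconfig      = v⊕-nonconfig
    ; v-range          = v⊕-range
    ; v-empty          = refl
    ; v-drop           = v⊕-drop
    }

mainTheorem10 : ∀ {c ℓ} (R : OrderedCommRing c ℓ) (P₁ P₂ : PES R)
                (p : OrderedCommRing.Carrier R) →
                OrderedCommRing._<_ R (OrderedCommRing.0# R) p →
                OrderedCommRing._<_ R p (OrderedCommRing.1# R) →
                IsPES R (Choice._≤⊕_ R P₁ P₂ p) (Choice._#⊕_ R P₁ P₂ p)
                  (Choice.v⊕ R P₁ P₂ p)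
mainTheorem10 R P₁ P₂ p 0<p p<1 = ChoiceIsPES.isPES R P₁ P₂ p (proj₁ 0<p , proj₁ p<1)
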